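{- Let $G=(V,E)$ be a graph with $n$ vertices and $m$ edges, let $d=4m+2$, and let $\mathcal{J}_G$ be the caching instance constructed from $G$ as described in the context. If $G$ has an independent set of size $K$, then there exists a service of $\mathcal{J}_G$ (under the optional policy) with total savings $(d-1)m+K/(n+1)$.
   Context: General caching under the optional policy: cache size $C$, pages with sizes and costs, a request sequence; a service starts with an empty cache, at every moment the cached pages have total size at most $C$, pages may be evicted at any time for free; a request to a cached page costs nothing, a request to an uncached page $p$ costs $\mathrm{cost}(p)$ and the service may (but need not) load $p$ into the cache. The savings of a service are the sum of the costs of all requested pages (over all requests) minus the cost of the service. Construction of $\mathcal{J}_G$. Fix an ordering $e_1,\dots,e_m$ of the edges and an ordering of the vertices. Cache size $C=2m+1$. For each vertex $v$ a vertex-page $p_v$ of size 1 and cost $1/(n+1)$. For each edge $e$ six edge-pages $a^e,\bar a^e,\alpha^e,b^e,\bar b^e,\beta^e$, all of cost 1; $\alpha^e,\beta^e$ have size 3 and the other four have size 2. The request sequence consists of an initial block $I$, then for each vertex $v$ in the fixed order: a request to $p_v$, then the $v$-phase, then a request to $p_v$; finally a final block $F$. The $v$-phase consists, for each edge $e$ incident with $v$ (in an arbitrary fixed order), of two adjacent blocks associated with $e$. The four blocks associated with edge $e$ are denoted $B^e_1,B^e_2,B^e_3,B^e_4$ in order of appearance (so $B^e_1,B^e_2$ are in the phase of one endpoint and $B^e_3,B^e_4$ in the phase of the other). In total there are $d=4m+2$ blocks. In each block $B$ (including $I,F$), for $k=1,\dots,m$ in this order, with $e=e_k$, the following requests are made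 in the listed order: if $B$ is before $B^e_1$: $\bar a^e$; if $B=B^e_1$: $\bar a^e,\alpha^e,b^e$; if $B=B^e_2$: $\alpha^e,a^e,b^e$; if $B$ is after $B^e_2$ and before $B^e_3$: $a^e,b^e$; if $B=B^e_3$: $a^e,b^e,\beta^e$; if $B=B^e_4$: $a^e,\beta^e,\bar b^e$; if $B$ is after $B^e_4$: $\bar b^e$. -}

module Defs where

open import Data.Nat using (ℕ; zero; suc; _+_; _*_; _≤_)
open import Data.Fin using (Fin)
open import Data.Fin.Properties using () renaming (_≟_ to _≟ᶠ_)
open import Data.Fin.Subset using (Subset; _∈_; ∣_∣)
open import Data.Bool using (Bool; true; false; if_then_else_)
open import Data.Maybe using (Maybe; just; nothing)
open import Data.List using (List; []; _∷_; _++_; concatMap; map; allFin; foldr)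
open import Data.List.Relation.Unary.Unique.Propositional using (Unique)
import Data.List.Membership.Propositional as LM
open import Data.Product using (_×_; _,_; proj₁; proj₂)
open import Data.Sum using (_⊎_)
open import Data.Unit using (⊤)
open import Data.Empty using (⊥)
open import Data.Integer using (+_)
open import Data.Rational using (ℚ; 0ℚ; 1ℚ) renaming (_+_ to _+ℚ_; _/_ to _/ℚ_)
open import Relation.Binary.PropositionalEquality using (_≡_; _≢_)
open import Relation.Nullary using (¬_; does)

-- Graphs: n vertices (Fin n, whose natural order is the fixed vertex
-- ordering), m edges e_0,…,e_{m-1} (the fixed edge ordering),
-- each edge given by its two endpoints.

record Graph (n m : ℕ) : Set where
  field
    edge    : Fin m → Fin n × Fin n
    noLoop  : ∀ k → proj₁ (edge k) ≢ proj₂ (edge k)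
    simple  : ∀ k l → (edge k ≡ edge l ⊎ edge k ≡ (proj₂ (edge l) , proj₁ (edge l))) → k ≡ l

open Graph public

Incident : ∀ {n m} → Graph n m → Fin n → Fin m → Set
Incident G v k = v ≡ proj₁ (edge G k) ⊎ v ≡ proj₂ (edge G k)

-- an arbitrary fixed order of the edges incident with each vertex
record IncidenceOrder {n m} (G : Graph n m) : Set where
  field
    order    : Fin n → List (Fin m)
    unique   : ∀ v → Unique (order v)
    complete : ∀ v k → (k LM.∈ order v → Incident G v k) × (Incident G v k → k LM.∈ order v)

open IncidenceOrder public

IndependentSet : ∀ {n m} → Graph n m → ℕ → Set
IndependentSet {n} {m} G K =
  Data.Product.Σ (Subset n) λ S → (∣ S ∣ ≡ K) ×
    (∀ k → ¬ (proj₁ (edge G k) ∈ S × proj₂ (edge G k) ∈ S))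

data EdgeKind : Set where
  a ā α b b̄ β : EdgeKind

data Page (n m : ℕ) : Set where
  vpage : Fin n → Page n m
  epage : EdgeKind → Fin m → Page n m

size : ∀ {n m} → Page n m → ℕ
size (vpage _)   = 1
size (epage α _) = 3
size (epage β _) = 3
size (epage _ _) = 2

cost : ∀ {n m} → Page n m → ℚ
cost {n} (vpage _) = + 1 /ℚ suc n
cost (epage _ _)   = 1ℚ

capacity : ℕ → ℕ
capacity m = 2 * m + 1

allKinds : List EdgeKind
allKinds = a ∷ ā ∷ α ∷ b ∷ b̄ ∷ β ∷ []

allPages : (n m : ℕ) → List (Page n m)
allPages n m = map vpage (allFin n) ++ concatMap (λ t → map (epage t) (allFin m)) allKinds

-- Request sequence.
-- A block is labelled by `just k` if it is one of the blocks associated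
-- with edge e_k, and by `nothing` for the blocks I and F.

data Item (n m : ℕ) : Set where
  vreq  : Fin n → Item n m
  block : Maybe (Fin m) → Item n m

items : ∀ {n m} (G : Graph n m) → IncidenceOrder G → List (Item n m)
items {n} {m} G O =
  block nothing ∷
  (concatMap (λ v → vreq v ∷ (concatMap (λ k → block (just k) ∷ block (just k) ∷ []) (order O v) ++ (vreq v ∷ [])))
             (allFin n)
   ++ (block nothing ∷ []))

-- Requests for edge e_k inside a block B.  `isK` says whether B is
-- associated with e_k, `before` is the number of blocks associated with
-- e_k that precede B.  (So isK ∧ before = j means B = B^e_{j+1};
-- ¬isK ∧ before = 0/2/4 means before B^e_1 / between B^e_2 and B^e_3 /
-- after B^e_4.  Other combinations do not occur.)
edgeReqs : ∀ {n m} → Fin m → Bool → ℕ → List (Page n m)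
edgeReqs k false 0 = epage ā k ∷ []
edgeReqs k true  0 = epage ā k ∷ epage α k ∷ epage b k ∷ []
edgeReqs k true  1 = epage α k ∷ epage a k ∷ epage b k ∷ []
edgeReqs k false 2 = epage a k ∷ epage b k ∷ []
edgeReqs k true  2 = epage a k ∷ epage b k ∷ epage β k ∷ []
edgeReqs k true  3 = epage a k ∷ epage β k ∷ epage b̄ k ∷ []
edgeReqs k false 4 = epage b̄ k ∷ []
edgeReqs k _     _ = []

isLabel : ∀ {m} → Maybe (Fin m) → Fin m → Bool
isLabel nothing  k = false
isLabel (just l) k = does (l ≟ᶠ k)

blockReqs : ∀ {n m} → Maybe (Fin m) → (Fin m → ℕ) → List (Page n m)
blockReqs {n} {m} lab cnt = concatMap (λ k → edgeReqs k (isLabel lab k) (cnt k)) (allFin m)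

bump : ∀ {m} → Maybe (Fin m) → (Fin m → ℕ) → Fin m → ℕ
bump lab cnt k = if isLabel lab k then suc (cnt k) else cnt k

render : ∀ {n m} → (Fin m → ℕ) → List (Item n m) → List (Page n m)
render cnt []              = []
render cnt (vreq v ∷ is)   = vpage v ∷ render cnt is
render cnt (block l ∷ is)  = blockReqs l cnt ++ render (bump l cnt) is

requests : ∀ {n m} (G : Graph n m) → IncidenceOrder G → List (Page n m)
requests G O = render (λ _ → 0) (items G O)

-- A service is
-- described by the list of cache contents c_2,…,c_{T+1}, where c_{t+1}
-- is the cache content at the moment of request t+1 (c_1 = ∅, the
-- cache starts empty).  Between requests pages may be evicted for free,
-- and the only page that may be loaded on request t is r_t, so
-- c_{t+1} ⊆ c_t ∪ {r_t}; every cache content has total size ≤ C.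
-- Request t costs nothing iff r_t ∈ c_t.

Cache : ℕ → ℕ → Set
Cache n m = Page n m → Bool

emptyCache : ∀ {n m} → Cache n m
emptyCache _ = false

cacheSize : ∀ {n m} → Cache n m → ℕ
cacheSize {n} {m} c = foldr (λ p s → (if c p then size p else 0) + s) 0 (allPages n m)

ValidService : ∀ {n m} → ℕ → Cache n m → List (Page n m) → List (Cache n m) → Set
ValidService C cur []       []         = ⊤
ValidService C cur (r ∷ rs) (nxt ∷ cs) =
  (∀ p → nxt p ≡ true → cur p ≡ true ⊎ p ≡ r) × (cacheSize nxt ≤ C) × ValidService C nxt rs cs
ValidService C cur _        _          = ⊥

-- savings = sum of costs of the requests served from the cache
-- (= total cost of all requests minus the cost of the service)
savings : ∀ {n m} → Cache n m → List (Page n m) → List (Cache n m) → ℚ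
savings cur (r ∷ rs) (nxt ∷ cs) = (if cur r then cost r else 0ℚ) +ℚ savings nxt rs cs
savings cur _        _          = 0ℚ

module Submission where

-- The service is produced by a policy that keeps, for every edge e, at most
-- one page of e (the slot of e) and at most one vertex page.  In the phase of
-- a vertex v ∈ S the page p_v stays cached, so the closing request to p_v is
-- served from the cache.  Each slot follows a small automaton serving exactly
-- one request of its edge in every block after I, i.e. (d-1)m requests of
-- cost 1.  The capacity 2m+1 is only at risk when a page of size 3 (α^e or
-- β^e) sits next to a vertex page: the automaton skips α^e while p_v is
-- cached, and independence of S ensures that β^e is needed only in the phase
-- of an endpoint outside S.

open import Defs
open import Algebra.Bundles using (CommutativeMonoid)
open import Data.Bool using (Bool; true; false; if_then_else_; not)
open import Data.Empty using (⊥-elim)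
open import Data.Fin using (Fin; zero; suc)
open import Data.Fin.Properties using (_≟_)
open import Data.Fin.Subset using (Subset)
import Data.Fin.Subset as Sub
open import Data.Vec using (lookup; []; _∷_)
open import Data.Vec.Properties using (lookup⇒[]=)
open import Data.Vec.Functional using (updateAt)
open import Data.Vec.Functional.Properties using (updateAt-updates; updateAt-minimal)
open import Data.Integer as ℤ using (+_)
import Data.Integer.Properties as ℤP
open import Data.Integer.Tactic.RingSolver using () renaming (solve-∀ to ℤ-solve)
open import Data.Nat.Tactic.RingSolver using () renaming (solve-∀ to ℕ-solve)
open import Data.List using (List; []; _∷_; _++_; map; concatMap; allFin; tabulate)
import Data.List.Properties as ListP
open import Data.List.Membership.Propositional using (_∈_; _∉_)
open import Data.List.Relation.Unary.Any using (here; there)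
import Data.List.Relation.Unary.All as All
open import Data.List.Relation.Unary.All.Properties using (All¬⇒¬Any)
open import Data.List.Relation.Unary.AllPairs using (_∷_)
open import Data.List.Relation.Unary.Unique.Propositional using (Unique)
open import Data.List.Relation.Unary.Unique.Propositional.Properties using (allFin⁺)
open import Data.List.Membership.Propositional.Properties using (∈-allFin)
open import Data.Maybe using (Maybe; just; nothing; is-just)
open import Data.Nat using (ℕ; zero; suc; _+_; _*_; _∸_; _≤_; _⊔_; z≤n; s≤s)
open import Data.Nat.ListAction using (sum)
open import Data.Nat.ListAction.Properties using (sum-++)
import Data.Nat.Properties as ℕP
open import Data.Product using (Σ; _×_; _,_; proj₁; proj₂)
open import Data.Rational using (ℚ; 0ℚ; 1ℚ; toℚᵘ) renaming (_+_ to _+ℚ_; _/_ to _/ℚ_)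
import Data.Rational.Properties as ℚP
import Data.Rational.Unnormalised as ℚᵘ
import Data.Rational.Unnormalised.Properties as ℚᵘP
open import Data.Sum using (_⊎_; inj₁; inj₂; map₁)
open import Data.Unit using (⊤; tt)
open import Function using (_∘_)
open import Relation.Binary.PropositionalEquality
open import Relation.Nullary using (Dec; does; ¬_; map′; yes; no)
open import Relation.Binary.Definitions using (DecidableEquality)
open import Relation.Nullary.Decidable using (dec-true; dec-false)

open import Algebra.Properties.CommutativeMonoid.Sum ℕP.+-0-commutativeMonoid
  using (∑-distrib-+; sum-cong-≗) renaming (sum to ∑)
open import Algebra.Properties.CommutativeSemigroup
  (CommutativeMonoid.commutativeSemigroup ℚP.+-0-commutativeMonoid) using (interchange)

/-+ : ∀ d x y → + (x + y) /ℚ suc d ≡ (+ x /ℚ suc d) +ℚ (+ y /ℚ suc d)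
/-+ d x y = ℚP.toℚᵘ-injective (begin
    toℚᵘ (+ (x + y) /ℚ suc d)                     ≈⟨ ℚP.toℚᵘ-fromℚᵘ (ℚᵘ.mkℚᵘ (+ (x + y)) d) ⟩
    ℚᵘ.mkℚᵘ (+ (x + y)) d                         ≈⟨ ℚᵘ.*≡* cross ⟩
    ℚᵘ.mkℚᵘ (+ x) d ℚᵘ.+ ℚᵘ.mkℚᵘ (+ y) d         ≈⟨ ℚᵘP.+-cong (from-mk x) (from-mk y) ⟨
    toℚᵘ (+ x /ℚ suc d) ℚᵘ.+ toℚᵘ (+ y /ℚ suc d)  ≈⟨ ℚP.toℚᵘ-homo-+ (+ x /ℚ suc d) (+ y /ℚ suc d) ⟨
    toℚᵘ ((+ x /ℚ suc d) +ℚ (+ y /ℚ suc d))       ∎)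
  where
  open ℚᵘP.≃-Reasoning
  from-mk : ∀ z → toℚᵘ (+ z /ℚ suc d) ℚᵘ.≃ ℚᵘ.mkℚᵘ (+ z) d
  from-mk z = ℚP.toℚᵘ-fromℚᵘ (ℚᵘ.mkℚᵘ (+ z) d)
  D = + suc d
  cross : + (x + y) ℤ.* (D ℤ.* D) ≡ (+ x ℤ.* D ℤ.+ + y ℤ.* D) ℤ.* D
  cross = trans (cong (ℤ._* (D ℤ.* D)) (sym (ℤP.pos-+ x y))) (distrib (+ x) (+ y) D)
    where
    distrib : ∀ p q z → (p ℤ.+ q) ℤ.* (z ℤ.* z) ≡ (p ℤ.* z ℤ.+ q ℤ.* z) ℤ.* z
    distrib = ℤ-solve

-- Every partial savings value of the service has the shape x + y/(n+1).
worth : (n x y : ℕ) → ℚ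
worth n x y = (+ x /ℚ 1) +ℚ (+ y /ℚ suc n)

worth-+ : ∀ n x y x′ y′ → worth n x y +ℚ worth n x′ y′ ≡ worth n (x + x′) (y + y′)
worth-+ n x y x′ y′ = begin
  ((+ x /ℚ 1) +ℚ (+ y /ℚ suc n)) +ℚ ((+ x′ /ℚ 1) +ℚ (+ y′ /ℚ suc n))
    ≡⟨ interchange (+ x /ℚ 1) (+ y /ℚ suc n) (+ x′ /ℚ 1) (+ y′ /ℚ suc n) ⟩
  ((+ x /ℚ 1) +ℚ (+ x′ /ℚ 1)) +ℚ ((+ y /ℚ suc n) +ℚ (+ y′ /ℚ suc n))
    ≡⟨ cong₂ _+ℚ_ (/-+ 0 x x′) (/-+ n y y′) ⟨
  worth n (x + x′) (y + y′) ∎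
  where open ≡-Reasoning

worth-0 : ∀ n → worth n 0 0 ≡ 0ℚ
worth-0 n = cong₂ _+ℚ_ (ℚP.0/n≡0 1) (ℚP.0/n≡0 (suc n))

bit : Bool → ℕ
bit x = if x then 1 else 0

bit≤1 : ∀ x → bit x ≤ 1
bit≤1 false = z≤n
bit≤1 true  = ℕP.≤-refl

hit-worth : ∀ n x y → (if x then 1ℚ else 0ℚ) +ℚ worth n y 0 ≡ worth n (bit x + y) 0
hit-worth n x y = trans (cong (_+ℚ worth n y 0) (served x)) (worth-+ n (bit x) 0 y 0)
  where
  served : ∀ x → (if x then 1ℚ else 0ℚ) ≡ worth n (bit x) 0
  served true  = sym (trans (cong ((+ 1 /ℚ 1) +ℚ_) (ℚP.0/n≡0 (suc n))) (ℚP.+-identityʳ 1ℚ))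
  served false = sym (worth-0 n)

vertex-worth : ∀ n x → (if x then + 1 /ℚ suc n else 0ℚ) +ℚ 0ℚ ≡ worth n 0 (bit x)
vertex-worth n true  = begin
  (+ 1 /ℚ suc n) +ℚ 0ℚ           ≡⟨ ℚP.+-identityʳ _ ⟩
  + 1 /ℚ suc n                   ≡⟨ ℚP.+-identityˡ _ ⟨
  0ℚ +ℚ (+ 1 /ℚ suc n)           ≡⟨ cong (_+ℚ (+ 1 /ℚ suc n)) (ℚP.0/n≡0 1) ⟨
  worth n 0 1                    ∎
  where open ≡-Reasoning
vertex-worth n false = trans (ℚP.+-identityʳ 0ℚ) (sym (worth-0 n))

point : ∀ {k} → Fin k → ℕ → Fin k → ℕ
point k c i = if does (k ≟ i) then c else 0

∑-const : ∀ k c → ∑ {k} (λ _ → c) ≡ k * c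
∑-const zero    c = refl
∑-const (suc k) c = cong (_+_ c) (∑-const k c)

∑-zero : ∀ k → ∑ {k} (λ _ → 0) ≡ 0
∑-zero k = trans (∑-const k 0) (ℕP.*-zeroʳ k)

∑-mono : ∀ {k} {f g : Fin k → ℕ} → (∀ i → f i ≤ g i) → ∑ f ≤ ∑ g
∑-mono {zero}  f≤g = z≤n
∑-mono {suc k} f≤g = ℕP.+-mono-≤ (f≤g zero) (∑-mono (f≤g ∘ suc))

∑-point : ∀ {k} (j : Fin k) c → ∑ (point j c) ≡ c
∑-point {suc k} zero    c = trans (cong (_+_ c) (∑-zero k)) (ℕP.+-identityʳ c)
∑-point {suc k} (suc j) c = ∑-point j c

sumL : ∀ {A : Set} → List A → (A → ℕ) → ℕ
sumL xs f = sum (map f xs)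

sumL-++ : ∀ {A : Set} (xs ys : List A) (f : A → ℕ) → sumL (xs ++ ys) f ≡ sumL xs f + sumL ys f
sumL-++ xs ys f = trans (cong sum (ListP.map-++ f xs ys)) (sum-++ (map f xs) (map f ys))

sumL-map : ∀ {A B : Set} (g : A → B) (xs : List A) (f : B → ℕ) → sumL (map g xs) f ≡ sumL xs (f ∘ g)
sumL-map g xs f = cong sum (sym (ListP.map-∘ xs))

sumL-concatMap : ∀ {A B : Set} (g : A → List B) (xs : List A) (f : B → ℕ) →
                 sumL (concatMap g xs) f ≡ sumL xs (λ x → sumL (g x) f)
sumL-concatMap g []       f = refl
sumL-concatMap g (x ∷ xs) f = trans (sumL-++ (g x) (concatMap g xs) f) (cong (_+_ (sumL (g x) f)) (sumL-concatMap g xs f))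

sumL-cong : ∀ {A : Set} (xs : List A) {f g : A → ℕ} → (∀ x → x ∈ xs → f x ≡ g x) → sumL xs f ≡ sumL xs g
sumL-cong []       eq = refl
sumL-cong (x ∷ xs) eq = cong₂ _+_ (eq x (here refl)) (sumL-cong xs (λ y y∈xs → eq y (there y∈xs)))

sumL-tabulate : ∀ {A : Set} {k} (g : Fin k → A) (f : A → ℕ) → sumL (tabulate g) f ≡ ∑ (f ∘ g)
sumL-tabulate {k = zero}  g f = refl
sumL-tabulate {k = suc k} g f = cong (_+_ (f (g zero))) (sumL-tabulate (g ∘ suc) f)

sumL-allFin : ∀ {k} (f : Fin k → ℕ) → sumL (allFin k) f ≡ ∑ f
sumL-allFin f = sumL-tabulate (λ i → i) f

sumL-∑ : ∀ {A : Set} {k} (xs : List A) (f : A → Fin k → ℕ) → sumL xs (∑ ∘ f) ≡ ∑ (λ i → sumL xs (λ x → f x i))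
sumL-∑ {k = k} []       f = sym (∑-zero k)
sumL-∑         (x ∷ xs) f = trans (cong (_+_ (∑ (f x))) (sumL-∑ xs f)) (sym (∑-distrib-+ (f x) _))

∑-bits : ∀ {k} (T : Subset k) → ∑ (λ v → bit (lookup T v)) ≡ Sub.∣ T ∣
∑-bits []           = refl
∑-bits (true  ∷ T)  = cong suc (∑-bits T)
∑-bits (false ∷ T)  = ∑-bits T

does-true : ∀ {A : Set} (d : Dec A) → does d ≡ true → A
does-true (yes witness) _ = witness

isLabel-self : ∀ {m} (k : Fin m) → isLabel (just k) k ≡ true
isLabel-self k = dec-true (k ≟ k) refl

isLabel-other : ∀ {m} {k j : Fin m} → j ≢ k → isLabel (just k) j ≡ false
isLabel-other j≢k = dec-false (_ ≟ _) (j≢k ∘ sym)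

by-label : ∀ {m} (P : Fin m → Bool → Set) (k : Fin m) → P k true → (∀ j → j ≢ k → P j false) →
           ∀ j → P j (isLabel (just k) j)
by-label P k at-k elsewhere j with j ≟ k
... | yes refl = subst (P k) (sym (isLabel-self k)) at-k
... | no  j≢k  = subst (P j) (sym (isLabel-other j≢k)) (elsewhere j j≢k)

bump-self : ∀ {m} (cnt : Fin m → ℕ) k → bump (just k) cnt k ≡ suc (cnt k)
bump-self cnt k = cong (λ l → if l then suc (cnt k) else cnt k) (isLabel-self k)

bump-other : ∀ {m} (cnt : Fin m → ℕ) {k j} → j ≢ k → bump (just k) cnt j ≡ cnt j
bump-other cnt {k} {j} j≢k = cong (λ l → if l then suc (cnt j) else cnt j) (isLabel-other j≢k)

∑-bump : ∀ {m} (cnt : Fin m → ℕ) k → ∑ (bump (just k) cnt) ≡ suc (∑ cnt)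
∑-bump {m} cnt k = begin
  ∑ (bump (just k) cnt)          ≡⟨ sum-cong-≗ (by-label (λ j l → (if l then suc (cnt j) else cnt j) ≡ cnt j + (if l then 1 else 0)) k
                                      (ℕP.+-comm 1 (cnt k)) (λ j _ → sym (ℕP.+-identityʳ (cnt j)))) ⟩
  ∑ (λ j → cnt j + point k 1 j)  ≡⟨ ∑-distrib-+ cnt (point k 1) ⟩
  ∑ cnt + ∑ (point k 1)          ≡⟨ cong (_+_ (∑ cnt)) (∑-point k 1) ⟩
  ∑ cnt + 1                      ≡⟨ ℕP.+-comm (∑ cnt) 1 ⟩
  suc (∑ cnt)                    ∎
  where open ≡-Reasoning

after : ∀ {n m} → (Fin m → ℕ) → List (Item n m) → Fin m → ℕ
after cnt []             = cnt
after cnt (vreq _ ∷ is)  = after cnt is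
after cnt (block l ∷ is) = after (bump l cnt) is

render-++ : ∀ {n m} (cnt : Fin m → ℕ) (xs ys : List (Item n m)) →
            render cnt (xs ++ ys) ≡ render cnt xs ++ render (after cnt xs) ys
render-++ cnt []             ys = refl
render-++ cnt (vreq v ∷ xs)  ys = cong (vpage v ∷_) (render-++ cnt xs ys)
render-++ cnt (block l ∷ xs) ys = trans (cong (blockReqs l cnt ++_) (render-++ (bump l cnt) xs ys))
                                        (sym (ListP.++-assoc (blockReqs l cnt) _ _))

after-++ : ∀ {n m} (cnt : Fin m → ℕ) (xs ys : List (Item n m)) → after cnt (xs ++ ys) ≡ after (after cnt xs) ys
after-++ cnt []             ys = refl
after-++ cnt (vreq v ∷ xs)  ys = after-++ cnt xs ys
after-++ cnt (block l ∷ xs) ys = after-++ (bump l cnt) xs ys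

-- A service given by a deterministic policy: a state machine whose states
-- determine the cache and whose step on request r may add no page other
-- than r.
module Policy {n m : ℕ} (C : ℕ) {State : Set}
  (cacheOf : State → Cache n m) (step : State → Page n m → State)
  (adds-only-request : ∀ σ r p → cacheOf (step σ r) p ≡ true → cacheOf σ p ≡ true ⊎ p ≡ r) where

  run : State → List (Page n m) → List (Cache n m)
  run σ []       = []
  run σ (r ∷ rs) = cacheOf (step σ r) ∷ run (step σ r) rs

  final : State → List (Page n m) → State
  final σ []       = σ
  final σ (r ∷ rs) = final (step σ r) rs

  gain : State → List (Page n m) → ℚ
  gain σ rs = savings (cacheOf σ) rs (run σ rs)

  Fits : State → List (Page n m) → Set
  Fits σ []       = ⊤
  Fits σ (r ∷ rs) = cacheSize (cacheOf (step σ r)) ≤ C × Fits (step σ r) rs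

  final-++ : ∀ σ xs ys → final σ (xs ++ ys) ≡ final (final σ xs) ys
  final-++ σ []       ys = refl
  final-++ σ (x ∷ xs) ys = final-++ (step σ x) xs ys

  gain-++ : ∀ σ xs ys → gain σ (xs ++ ys) ≡ gain σ xs +ℚ gain (final σ xs) ys
  gain-++ σ []       ys = sym (ℚP.+-identityˡ _)
  gain-++ σ (x ∷ xs) ys = trans (cong (hit +ℚ_) (gain-++ (step σ x) xs ys))
                                (sym (ℚP.+-assoc hit (gain (step σ x) xs) _))
    where hit = if cacheOf σ x then cost x else 0ℚ

  Fits-++ : ∀ σ xs ys → Fits σ xs → Fits (final σ xs) ys → Fits σ (xs ++ ys)
  Fits-++ σ []       ys _            fits = fits
  Fits-++ σ (x ∷ xs) ys (ok , fitsx) fits = ok , Fits-++ (step σ x) xs ys fitsx fits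

  serves : ∀ {c} σ rs → (∀ p → c p ≡ cacheOf σ p) → Fits σ rs → ValidService C c rs (run σ rs)
  serves σ []       c≗ _           = tt
  serves σ (r ∷ rs) c≗ (ok , fits) =
    (λ p new → map₁ (trans (c≗ p)) (adds-only-request σ r p new)) , ok ,
    serves (step σ r) rs (λ _ → refl) fits

  saves : ∀ {c} σ rs → (∀ p → c p ≡ cacheOf σ p) → savings c rs (run σ rs) ≡ gain σ rs
  saves σ []       c≗ = refl
  saves σ (r ∷ rs) c≗ = cong (λ x → (if x then cost r else 0ℚ) +ℚ gain (step σ r) rs) (c≗ r)

-- Edge pages of one edge: their kinds, coded in Fin 6 to obtain decidable equality.
code : EdgeKind → Fin 6
code a = zero
code ā = suc zero
code α = suc (suc zero)
code b = suc (suc (suc zero))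
code b̄ = suc (suc (suc (suc zero)))
code β = suc (suc (suc (suc (suc zero))))

decode : Fin 6 → EdgeKind
decode zero                                = a
decode (suc zero)                          = ā
decode (suc (suc zero))                    = α
decode (suc (suc (suc zero)))              = b
decode (suc (suc (suc (suc zero))))        = b̄
decode (suc (suc (suc (suc (suc zero)))))  = β

decode-code : ∀ t → decode (code t) ≡ t
decode-code a = refl
decode-code ā = refl
decode-code α = refl
decode-code b = refl
decode-code b̄ = refl
decode-code β = refl

_≟ₖ_ : DecidableEquality EdgeKind
s ≟ₖ t = map′ code-injective (cong code) (code s ≟ code t)
  where
  code-injective : code s ≡ code t → s ≡ t
  code-injective e = trans (sym (decode-code s)) (trans (cong decode e) (decode-code t))

-- The policy keeps at most one page of each edge: the slot of the edge.
Slot : Set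
Slot = Maybe EdgeKind

kindSize : EdgeKind → ℕ
kindSize α = 3
kindSize β = 3
kindSize _ = 2

slotSize : Slot → ℕ
slotSize nothing  = 0
slotSize (just t) = kindSize t

holds : Slot → EdgeKind → Bool
holds nothing  t = false
holds (just s) t = does (t ≟ₖ s)

holds-just : ∀ s t → holds (just s) t ≡ true → t ≡ s
holds-just s t = does-true (t ≟ₖ s)

-- When the page t of the edge is requested, the slot
-- h is replaced by t iff `loads busy h t`, where busy says that a vertex
-- page is cached.  The only decision depending on busy is in B₁: with a
-- vertex page cached, the size-3 page α is not loaded and the slot keeps ā.
loads : Bool → Slot → EdgeKind → Bool
loads _    nothing  ā = true
loads busy (just ā) α = not busy
loads _    (just ā) b = true
loads _    (just α) a = true
loads _    (just b) β = true
loads _    (just a) b̄ = true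
loads _    (just β) b̄ = true
loads _    _        _ = false

next : Bool → Slot → EdgeKind → Slot
next busy h t = if loads busy h t then just t else h

runE : Bool → Slot → List EdgeKind → Slot
runE busy h []       = h
runE busy h (t ∷ ts) = runE busy (next busy h t) ts

hitsE : Bool → Slot → List EdgeKind → ℕ
hitsE busy h []       = 0
hitsE busy h (t ∷ ts) = bit (holds h t) + hitsE busy (next busy h t) ts

peak : Bool → Slot → List EdgeKind → ℕ
peak busy h []       = slotSize h
peak busy h (t ∷ ts) = slotSize h ⊔ peak busy (next busy h t) ts

peak-start : ∀ busy h ts → slotSize h ≤ peak busy h ts
peak-start busy h []       = ℕP.≤-refl
peak-start busy h (t ∷ ts) = ℕP.m≤m⊔n _ _

peak-next : ∀ busy h t ts → peak busy (next busy h t) ts ≤ peak busy h (t ∷ ts)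
peak-next busy h t ts = ℕP.m≤n⊔m _ _

kinds : Bool → ℕ → List EdgeKind
kinds false 0 = ā ∷ []
kinds true  0 = ā ∷ α ∷ b ∷ []
kinds true  1 = α ∷ a ∷ b ∷ []
kinds false 2 = a ∷ b ∷ []
kinds true  2 = a ∷ b ∷ β ∷ []
kinds true  3 = a ∷ β ∷ b̄ ∷ []
kinds false 4 = b̄ ∷ []
kinds _     _ = []

-- The resting states of a slot outside the blocks of its edge: holding ā
-- before B₁ (count 0), a or b between B₂ and B₃ (count 2), b̄ after B₄ (count 4).
Resting : ℕ → Slot → Set
Resting c h = (c ≡ 0 × h ≡ just ā) ⊎ (c ≡ 2 × h ≡ just a) ⊎ (c ≡ 2 × h ≡ just b) ⊎ (c ≡ 4 × h ≡ just b̄)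

resting-block : ∀ busy c h → Resting c h →
  runE busy h (kinds false c) ≡ h × hitsE busy h (kinds false c) ≡ 1 × peak busy h (kinds false c) ≤ 2
resting-block busy _ _ (inj₁ (refl , refl))               = refl , refl , ℕP.≤-refl
resting-block busy _ _ (inj₂ (inj₁ (refl , refl)))        = refl , refl , ℕP.≤-refl
resting-block busy _ _ (inj₂ (inj₂ (inj₁ (refl , refl)))) = refl , refl , ℕP.≤-refl
resting-block busy _ _ (inj₂ (inj₂ (inj₂ (refl , refl)))) = refl , refl , ℕP.≤-refl

resting-size : ∀ {c h} → Resting c h → slotSize h ≤ 2
resting-size {c} {h} r = ℕP.≤-trans (peak-start false h (kinds false c)) (proj₂ (proj₂ (resting-block false c h r)))

spare : Bool → ℕ
spare busy = bit (not busy)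

spare+busy : ∀ busy → spare busy + bit busy ≤ 1
spare+busy false = ℕP.≤-refl
spare+busy true  = ℕP.≤-refl

-- The states from which a slot can enter the pair of blocks of its edge;
-- b is allowed only while no vertex page is cached (it leads to β, of size 3).
Ready : Bool → ℕ → Slot → Set
Ready busy c h = (c ≡ 0 × h ≡ just ā) ⊎ (c ≡ 2 × h ≡ just a) ⊎ (c ≡ 2 × h ≡ just b × busy ≡ false)

ServesOnce : Bool → ℕ → Slot → Set
ServesOnce busy c h = hitsE busy h (kinds true c) ≡ 1 × peak busy h (kinds true c) ≤ 2 + spare busy

ready-pair : ∀ busy c h → Ready busy c h →
             ServesOnce busy c h × ServesOnce busy (suc c) (runE busy h (kinds true c))
ready-pair false _ _ (inj₁ (refl , refl))                = (refl , ℕP.≤-refl) , (refl , ℕP.≤-refl)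
ready-pair true  _ _ (inj₁ (refl , refl))                = (refl , ℕP.≤-refl) , (refl , ℕP.≤-refl)
ready-pair busy  _ _ (inj₂ (inj₁ (refl , refl)))         = (refl , ℕP.m≤m+n 2 _) , (refl , ℕP.m≤m+n 2 _)
ready-pair _     _ _ (inj₂ (inj₂ (refl , refl , refl)))  = (refl , ℕP.≤-refl) , (refl , ℕP.≤-refl)

afterPair : Bool → ℕ → Slot → Slot
afterPair busy c h = runE busy (runE busy h (kinds true c)) (kinds true (suc c))

-- Between the two phases of its endpoints an edge has count 2 and its slot
-- holds a, or b provided the endpoint still ahead is not in the set.
Halfway : Bool → ℕ → Slot → Set
Halfway aheadIn c h = c ≡ 2 × (h ≡ just a ⊎ (h ≡ just b × aheadIn ≡ false))

-- The invariant of an edge {x, y} across the vertex phases, given whether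
-- the phases of x and y are still ahead and whether x, y are in the set.
EdgeInv : (xAhead yAhead xIn yIn : Bool) → ℕ → Slot → Set
EdgeInv true  true  _   _   c h = c ≡ 0 × h ≡ just ā
EdgeInv false false _   _   c h = c ≡ 4 × h ≡ just b̄
EdgeInv true  false xIn _   c h = Halfway xIn c h
EdgeInv false true  _   yIn c h = Halfway yIn c h

EdgeInv-sym : ∀ xA yA xIn yIn c h → EdgeInv xA yA xIn yIn c h → EdgeInv yA xA yIn xIn c h
EdgeInv-sym true  true  _ _ _ _ inv = inv
EdgeInv-sym true  false _ _ _ _ inv = inv
EdgeInv-sym false true  _ _ _ _ inv = inv
EdgeInv-sym false false _ _ _ _ inv = inv

EdgeInv-resting : ∀ xA yA xIn yIn c h → EdgeInv xA yA xIn yIn c h → Resting c h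
EdgeInv-resting true  true  _ _ _ _ (refl , refl)             = inj₁ (refl , refl)
EdgeInv-resting false false _ _ _ _ (refl , refl)             = inj₂ (inj₂ (inj₂ (refl , refl)))
EdgeInv-resting true  false _ _ _ _ (refl , inj₁ refl)        = inj₂ (inj₁ (refl , refl))
EdgeInv-resting true  false _ _ _ _ (refl , inj₂ (refl , _))  = inj₂ (inj₂ (inj₁ (refl , refl)))
EdgeInv-resting false true  _ _ _ _ (refl , inj₁ refl)        = inj₂ (inj₁ (refl , refl))
EdgeInv-resting false true  _ _ _ _ (refl , inj₂ (refl , _))  = inj₂ (inj₂ (inj₁ (refl , refl)))

-- This is where independence of the set is used.
pair-advance : ∀ yA xIn yIn c h → (xIn ≡ true → yIn ≡ false) → EdgeInv true yA xIn yIn c h →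
               Ready xIn c h × EdgeInv false yA xIn yIn (2 + c) (afterPair xIn c h)
pair-advance true  true  yIn _ _ indep (refl , refl)              = inj₁ (refl , refl) , refl , inj₂ (refl , indep refl)
pair-advance true  false yIn _ _ indep (refl , refl)              = inj₁ (refl , refl) , refl , inj₁ refl
pair-advance false xIn   yIn _ _ indep (refl , inj₁ refl)         = inj₂ (inj₁ (refl , refl)) , refl , refl
pair-advance false _     yIn _ _ indep (refl , inj₂ (refl , refl)) = inj₂ (inj₂ (refl , refl , refl)) , refl , refl

module Service {n m : ℕ} (S : Subset n) where

  record State : Set where
    constructor ⟨_,_⟩
    field
      slot  : Fin m → Slot
      vslot : Maybe (Fin n)
  open State public

  inS : Fin n → Bool
  inS v = lookup S v

  busy : State → Bool
  busy σ = is-just (vslot σ)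

  holdsV : Maybe (Fin n) → Fin n → Bool
  holdsV nothing  v = false
  holdsV (just w) v = does (w ≟ v)

  cacheOf : State → Cache n m
  cacheOf σ (vpage v)   = holdsV (vslot σ) v
  cacheOf σ (epage t k) = holds (slot σ k) t

  opening : Fin n → Maybe (Fin n)
  opening v = if inS v then just v else nothing

  -- a request to a vertex page empties a full vertex slot (this is the
  -- second request of its phase), and otherwise opens the phase
  vstep : Maybe (Fin n) → Fin n → Maybe (Fin n)
  vstep (just _) v = nothing
  vstep nothing  v = opening v

  busy-opening : ∀ v → is-just (opening v) ≡ inS v
  busy-opening v with inS v
  ... | true  = refl
  ... | false = refl

  holds-opening : ∀ v → holdsV (opening v) v ≡ inS v
  holds-opening v with inS v
  ... | true  = dec-true (v ≟ v) refl
  ... | false = refl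

  closing : ∀ v → vstep (opening v) v ≡ nothing
  closing v with inS v in v∈?S
  ... | true  = refl
  ... | false = cong (λ x → if x then just v else nothing) v∈?S

  step : State → Page n m → State
  step σ (vpage v)   = ⟨ slot σ , vstep (vslot σ) v ⟩
  step σ (epage t k) = ⟨ updateAt (slot σ) k (λ h → next (busy σ) h t) , vslot σ ⟩

  vstep-adds-only : ∀ V v w → holdsV (vstep V v) w ≡ true → w ≡ v
  vstep-adds-only (just _) v w ()
  vstep-adds-only nothing  v w with inS v
  ... | true  = λ new → sym (does-true (v ≟ w) new)
  ... | false = λ ()

  estep-adds-only : ∀ busy (sl : Fin m → Slot) k t j t′ → holds (updateAt sl k (λ h → next busy h t) j) t′ ≡ true →
                    holds (sl j) t′ ≡ true ⊎ (t′ ≡ t × j ≡ k)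
  estep-adds-only busy sl k t j t′ new with j ≟ k
  ... | no j≢k = inj₁ (trans (cong (λ h → holds h t′) (sym (updateAt-minimal j k sl j≢k))) new)
  ... | yes refl rewrite updateAt-updates j {λ h → next busy h t} sl with loads busy (sl j) t
  ...   | true  = inj₂ (holds-just t t′ new , refl)
  ...   | false = inj₁ new

  adds-only-request : ∀ σ r p → cacheOf (step σ r) p ≡ true → cacheOf σ p ≡ true ⊎ p ≡ r
  adds-only-request σ (vpage v)   (vpage w)    new = inj₂ (cong vpage (vstep-adds-only (vslot σ) v w new))
  adds-only-request σ (vpage v)   (epage t k)  new = inj₁ new
  adds-only-request σ (epage t k) (vpage w)    new = inj₁ new
  adds-only-request σ (epage t k) (epage t′ j) new with estep-adds-only (busy σ) (slot σ) k t j t′ new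
  ... | inj₁ old           = inj₁ old
  ... | inj₂ (t′≡t , j≡k)  = inj₂ (cong₂ epage t′≡t j≡k)

  open Policy (capacity m) cacheOf step adds-only-request public

  cacheSize-state : ∀ σ → cacheSize (cacheOf σ) ≡ bit (busy σ) + ∑ (slotSize ∘ slot σ)
  cacheSize-state σ = begin
    cacheSize (cacheOf σ)
      ≡⟨ ListP.foldr-map _+_ occupied 0 (allPages n m) ⟨
    sumL (map vpage (allFin n) ++ concatMap (λ t → map (epage t) (allFin m)) allKinds) occupied
      ≡⟨ sumL-++ (map vpage (allFin n)) _ occupied ⟩
    sumL (map vpage (allFin n)) occupied + sumL (concatMap (λ t → map (epage t) (allFin m)) allKinds) occupied
      ≡⟨ cong₂ _+_ (trans (sumL-map vpage (allFin n) occupied) (sumL-allFin (occupied ∘ vpage))) edges ⟩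
    ∑ (λ v → bit (holdsV (vslot σ) v)) + ∑ (slotSize ∘ slot σ)
      ≡⟨ cong (_+ ∑ (slotSize ∘ slot σ)) (vertices (vslot σ)) ⟩
    bit (busy σ) + ∑ (slotSize ∘ slot σ) ∎
    where
    open ≡-Reasoning
    occupied : Page n m → ℕ
    occupied p = if cacheOf σ p then size p else 0
    vertices : ∀ V → ∑ (λ v → bit (holdsV V v)) ≡ bit (is-just V)
    vertices nothing  = ∑-zero n
    vertices (just w) = ∑-point w 1
    kinds-of-slot : ∀ h k → sumL allKinds (λ t → if holds h t then size (epage {n} {m} t k) else 0) ≡ slotSize h
    kinds-of-slot nothing  k = refl
    kinds-of-slot (just a) k = refl
    kinds-of-slot (just ā) k = refl
    kinds-of-slot (just α) k = refl
    kinds-of-slot (just b) k = refl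
    kinds-of-slot (just b̄) k = refl
    kinds-of-slot (just β) k = refl
    edges : sumL (concatMap (λ t → map (epage t) (allFin m)) allKinds) occupied ≡ ∑ (slotSize ∘ slot σ)
    edges = begin
      sumL (concatMap (λ t → map (epage t) (allFin m)) allKinds) occupied
        ≡⟨ sumL-concatMap (λ t → map (epage t) (allFin m)) allKinds occupied ⟩
      sumL allKinds (λ t → sumL (map (epage t) (allFin m)) occupied)
        ≡⟨ sumL-cong allKinds (λ t _ → trans (sumL-map (epage t) (allFin m) occupied) (sumL-allFin (occupied ∘ epage t))) ⟩
      sumL allKinds (λ t → ∑ (λ k → occupied (epage t k)))
        ≡⟨ sumL-∑ allKinds (λ t k → occupied (epage t k)) ⟩
      ∑ (λ k → sumL allKinds (λ t → occupied (epage t k)))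
        ≡⟨ sum-cong-≗ (λ k → kinds-of-slot (slot σ k) k) ⟩
      ∑ (slotSize ∘ slot σ) ∎

  -- Budgets: every edge slot may use 2 units plus an extra amount; the
  -- extras and the vertex slot share the one remaining unit of C = 2m+1.
  Room : (Fin m → ℕ) → Bool → Set
  Room extra busy = ∑ extra + bit busy ≤ 1

  Within : (Fin m → ℕ) → State → Set
  Within extra σ = ∀ k → slotSize (slot σ k) ≤ 2 + extra k

  fits-budget : ∀ σ extra → Room extra (busy σ) → Within extra σ → cacheSize (cacheOf σ) ≤ capacity m
  fits-budget σ extra room within = begin
    cacheSize (cacheOf σ)                   ≡⟨ cacheSize-state σ ⟩
    bit (busy σ) + ∑ (slotSize ∘ slot σ)    ≤⟨ ℕP.+-monoʳ-≤ (bit (busy σ)) (∑-mono within) ⟩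
    bit (busy σ) + ∑ (λ k → 2 + extra k)    ≡⟨ cong (_+_ (bit (busy σ))) (∑-distrib-+ {m} (λ _ → 2) extra) ⟩
    bit (busy σ) + (∑ {m} (λ _ → 2) + ∑ extra)  ≡⟨ cong (λ s → bit (busy σ) + (s + ∑ extra)) (trans (∑-const m 2) (ℕP.*-comm m 2)) ⟩
    bit (busy σ) + (2 * m + ∑ extra)        ≡⟨ shuffle (bit (busy σ)) (2 * m) (∑ extra) ⟩
    2 * m + (∑ extra + bit (busy σ))        ≤⟨ ℕP.+-monoʳ-≤ (2 * m) room ⟩
    2 * m + 1                               ∎
    where
    open ℕP.≤-Reasoning
    shuffle : ∀ x y z → x + (y + z) ≡ y + (z + x)
    shuffle = ℕ-solve

  edgeReqsOf : Fin m → List EdgeKind → List (Page n m)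
  edgeReqsOf k = map (λ t → epage t k)

  record EdgeRun (extra : Fin m → ℕ) (σ : State) (k : Fin m) (ts : List EdgeKind) : Set where
    field
      fits   : Fits σ (edgeReqsOf k ts)
      within : Within extra (final σ (edgeReqsOf k ts))
      slot-k : slot (final σ (edgeReqsOf k ts)) k ≡ runE (busy σ) (slot σ k) ts
      slot-≢ : ∀ i → i ≢ k → slot (final σ (edgeReqsOf k ts)) i ≡ slot σ i
      vslot≡ : vslot (final σ (edgeReqsOf k ts)) ≡ vslot σ
      gain≡  : gain σ (edgeReqsOf k ts) ≡ worth n (hitsE (busy σ) (slot σ k) ts) 0

  edge-run : ∀ extra σ k ts → Room extra (busy σ) → Within extra σ →
             peak (busy σ) (slot σ k) ts ≤ 2 + extra k → EdgeRun extra σ k ts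
  edge-run extra σ k []       room within _  = record
    { fits = tt ; within = within ; slot-k = refl ; slot-≢ = λ _ _ → refl ; vslot≡ = refl ; gain≡ = sym (worth-0 n) }
  edge-run extra σ k (t ∷ ts) room within pk = record
    { fits   = fits-budget σ′ extra room within′ , EdgeRun.fits rest
    ; within = EdgeRun.within rest
    ; slot-k = trans (EdgeRun.slot-k rest) (cong (λ h → runE (busy σ) h ts) moved)
    ; slot-≢ = λ i i≢k → trans (EdgeRun.slot-≢ rest i i≢k) (updateAt-minimal i k (slot σ) i≢k)
    ; vslot≡ = EdgeRun.vslot≡ rest
    ; gain≡  = begin
        served +ℚ gain σ′ (edgeReqsOf k ts)      ≡⟨ cong (served +ℚ_) (EdgeRun.gain≡ rest) ⟩
        served +ℚ worth n (hitsE (busy σ) (slot σ′ k) ts) 0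
                                                 ≡⟨ cong (λ h → served +ℚ worth n (hitsE (busy σ) h ts) 0) moved ⟩
        served +ℚ worth n later 0                ≡⟨ hit-worth n (holds (slot σ k) t) later ⟩
        worth n (hitsE (busy σ) (slot σ k) (t ∷ ts)) 0 ∎
    }
    where
    open ≡-Reasoning
    σ′ = step σ (epage t k)
    served = if holds (slot σ k) t then 1ℚ else 0ℚ
    later = hitsE (busy σ) (next (busy σ) (slot σ k) t) ts
    moved : slot σ′ k ≡ next (busy σ) (slot σ k) t
    moved = updateAt-updates k (slot σ)
    pk′ : peak (busy σ) (slot σ′ k) ts ≤ 2 + extra k
    pk′ = subst (λ h → peak (busy σ) h ts ≤ 2 + extra k) (sym moved) (ℕP.≤-trans (peak-next (busy σ) (slot σ k) t ts) pk)
    within′ : Within extra σ′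
    within′ i with i ≟ k
    ... | yes refl = ℕP.≤-trans (peak-start (busy σ) (slot σ′ i) ts) pk′
    ... | no  i≢k  = subst (λ h → slotSize h ≤ 2 + extra i) (sym (updateAt-minimal i k (slot σ) i≢k)) (within i)
    rest = edge-run extra σ′ k ts room within′ pk′

  blockOf : (Fin m → List EdgeKind) → List (Fin m) → List (Page n m)
  blockOf L js = concatMap (λ j → edgeReqsOf j (L j)) js

  record BlockRun (extra : Fin m → ℕ) (σ : State) (L : Fin m → List EdgeKind) (js : List (Fin m)) : Set where
    field
      fits   : Fits σ (blockOf L js)
      within : Within extra (final σ (blockOf L js))
      slot-∈ : ∀ j → j ∈ js → slot (final σ (blockOf L js)) j ≡ runE (busy σ) (slot σ j) (L j)
      slot-∉ : ∀ j → j ∉ js → slot (final σ (blockOf L js)) j ≡ slot σ j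
      vslot≡ : vslot (final σ (blockOf L js)) ≡ vslot σ
      gain≡  : gain σ (blockOf L js) ≡ worth n (sumL js (λ j → hitsE (busy σ) (slot σ j) (L j))) 0

  block-run : ∀ extra σ L js → Unique js → Room extra (busy σ) → Within extra σ →
              (∀ j → j ∈ js → peak (busy σ) (slot σ j) (L j) ≤ 2 + extra j) → BlockRun extra σ L js
  block-run extra σ L []       _              room within _     = record
    { fits = tt ; within = within ; slot-∈ = λ _ () ; slot-∉ = λ _ _ → refl ; vslot≡ = refl ; gain≡ = sym (worth-0 n) }
  block-run extra σ L (j ∷ js) (j-fresh ∷ uniq) room within peaks = record
    { fits   = Fits-++ σ (edgeReqsOf j (L j)) (blockOf L js) (EdgeRun.fits E) (BlockRun.fits B)
    ; within = subst (Within extra) (sym split) (BlockRun.within B)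
    ; slot-∈ = slot-∈
    ; slot-∉ = λ i i∉ → trans (slot-after i) (trans (BlockRun.slot-∉ B i (i∉ ∘ there)) (EdgeRun.slot-≢ E i (i∉ ∘ here)))
    ; vslot≡ = trans (cong vslot split) (trans (BlockRun.vslot≡ B) (EdgeRun.vslot≡ E))
    ; gain≡  = trans (gain-++ σ (edgeReqsOf j (L j)) (blockOf L js))
                 (trans (cong₂ _+ℚ_ (EdgeRun.gain≡ E) (trans (BlockRun.gain≡ B) (cong (λ s → worth n s 0) same-hits)))
                        (worth-+ n (hitsE (busy σ) (slot σ j) (L j)) 0 _ 0))
    }
    where
    E  = edge-run extra σ j (L j) room within (peaks j (here refl))
    σ₁ = final σ (edgeReqsOf j (L j))
    split : final σ (blockOf L (j ∷ js)) ≡ final σ₁ (blockOf L js)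
    split = final-++ σ (edgeReqsOf j (L j)) (blockOf L js)
    slot-after : ∀ i → slot (final σ (blockOf L (j ∷ js))) i ≡ slot (final σ₁ (blockOf L js)) i
    slot-after i = cong (λ τ → slot τ i) split
    busy≡ : busy σ₁ ≡ busy σ
    busy≡ = cong is-just (EdgeRun.vslot≡ E)
    untouched : ∀ i → i ∈ js → slot σ₁ i ≡ slot σ i
    untouched i i∈js = EdgeRun.slot-≢ E i (λ i≡j → All.lookup j-fresh i∈js (sym i≡j))
    B = block-run extra σ₁ L js uniq (subst (Room extra) (sym busy≡) room) (EdgeRun.within E)
          (λ i i∈js → subst₂ (λ x h → peak x h (L i) ≤ 2 + extra i) (sym busy≡) (sym (untouched i i∈js)) (peaks i (there i∈js)))
    same-run : ∀ i → i ∈ js → runE (busy σ₁) (slot σ₁ i) (L i) ≡ runE (busy σ) (slot σ i) (L i)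
    same-run i i∈js = cong₂ (λ x h → runE x h (L i)) busy≡ (untouched i i∈js)
    same-hits : sumL js (λ i → hitsE (busy σ₁) (slot σ₁ i) (L i)) ≡ sumL js (λ i → hitsE (busy σ) (slot σ i) (L i))
    same-hits = sumL-cong js (λ i i∈js → cong₂ (λ x h → hitsE x h (L i)) busy≡ (untouched i i∈js))
    slot-∈ : ∀ i → i ∈ j ∷ js → slot (final σ (blockOf L (j ∷ js))) i ≡ runE (busy σ) (slot σ i) (L i)
    slot-∈ i (here refl) = trans (slot-after i) (trans (BlockRun.slot-∉ B i (All¬⇒¬Any j-fresh)) (EdgeRun.slot-k E))
    slot-∈ i (there i∈js) = trans (slot-after i) (trans (BlockRun.slot-∈ B i i∈js) (same-run i i∈js))

  edgeReqs-kinds : ∀ k lab c → edgeReqs {n} {m} k lab c ≡ edgeReqsOf k (kinds lab c)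
  edgeReqs-kinds k false 0 = refl
  edgeReqs-kinds k false 1 = refl
  edgeReqs-kinds k false 2 = refl
  edgeReqs-kinds k false 3 = refl
  edgeReqs-kinds k false 4 = refl
  edgeReqs-kinds k false (suc (suc (suc (suc (suc c))))) = refl
  edgeReqs-kinds k true  0 = refl
  edgeReqs-kinds k true  1 = refl
  edgeReqs-kinds k true  2 = refl
  edgeReqs-kinds k true  3 = refl
  edgeReqs-kinds k true  (suc (suc (suc (suc c)))) = refl

  blockReqs-blockOf : ∀ lab cnt → blockReqs {n} lab cnt ≡ blockOf (λ j → kinds (isLabel lab j) (cnt j)) (allFin m)
  blockReqs-blockOf lab cnt = ListP.concatMap-cong (λ j → edgeReqs-kinds j (isLabel lab j) (cnt j)) (allFin m)

  record Outcome (σ : State) (rs : List (Page n m)) (newSlot : Fin m → Slot) (hits : ℕ) : Set where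
    field
      fits   : Fits σ rs
      slot≡  : ∀ j → slot (final σ rs) j ≡ newSlot j
      vslot≡ : vslot (final σ rs) ≡ vslot σ
      gain≡  : gain σ rs ≡ worth n hits 0

  Outcome-++ : ∀ {σ xs ys f g x y} → Outcome σ xs f x → Outcome (final σ xs) ys g y → Outcome σ (xs ++ ys) g (x + y)
  Outcome-++ {σ} {xs} {ys} {x = x} {y} O₁ O₂ = record
    { fits   = Fits-++ σ xs ys (Outcome.fits O₁) (Outcome.fits O₂)
    ; slot≡  = λ j → trans (cong (λ τ → slot τ j) split) (Outcome.slot≡ O₂ j)
    ; vslot≡ = trans (cong vslot split) (trans (Outcome.vslot≡ O₂) (Outcome.vslot≡ O₁))
    ; gain≡  = trans (gain-++ σ xs ys) (trans (cong₂ _+ℚ_ (Outcome.gain≡ O₁) (Outcome.gain≡ O₂)) (worth-+ n x 0 y 0))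
    }
    where split = final-++ σ xs ys

  serve-block : ∀ σ lab cnt extra → Room extra (busy σ) →
          (∀ j → peak (busy σ) (slot σ j) (kinds (isLabel lab j) (cnt j)) ≤ 2 + extra j) →
          Outcome σ (blockReqs lab cnt) (λ j → runE (busy σ) (slot σ j) (kinds (isLabel lab j) (cnt j)))
                  (∑ (λ j → hitsE (busy σ) (slot σ j) (kinds (isLabel lab j) (cnt j))))
  serve-block σ lab cnt extra room peaks rewrite blockReqs-blockOf lab cnt = record
    { fits   = BlockRun.fits R
    ; slot≡  = λ j → BlockRun.slot-∈ R j (∈-allFin j)
    ; vslot≡ = BlockRun.vslot≡ R
    ; gain≡  = trans (BlockRun.gain≡ R) (cong (λ s → worth n s 0) (sumL-allFin (λ j → hitsE (busy σ) (slot σ j) (L j))))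
    }
    where
    L : Fin m → List EdgeKind
    L j = kinds (isLabel lab j) (cnt j)
    R = block-run extra σ L (allFin m) (allFin⁺ m) room
          (λ j → ℕP.≤-trans (peak-start (busy σ) (slot σ j) (L j)) (peaks j)) (λ j _ → peaks j)

  Outcome-≡ : ∀ {σ rs f g x y} → (∀ j → f j ≡ g j) → x ≡ y → Outcome σ rs f x → Outcome σ rs g y
  Outcome-≡ f≗g x≡y O = record
    { fits   = Outcome.fits O
    ; slot≡  = λ j → trans (Outcome.slot≡ O j) (f≗g j)
    ; vslot≡ = Outcome.vslot≡ O
    ; gain≡  = trans (Outcome.gain≡ O) (cong (λ s → worth n s 0) x≡y)
    }

  no-extra : ∀ busy → Room (λ _ → 0) busy
  no-extra busy = subst (λ s → s + bit busy ≤ 1) (sym (∑-zero m)) (bit≤1 busy)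

  resting-unlabelled : ∀ σ cnt → (∀ j → Resting (cnt j) (slot σ j)) → Outcome σ (blockReqs nothing cnt) (slot σ) m
  resting-unlabelled σ cnt rest = Outcome-≡ stays all-served O
    where
    x = busy σ
    O = serve-block σ nothing cnt (λ _ → 0) (no-extra x) (λ j → proj₂ (proj₂ (resting-block x _ _ (rest j))))
    stays = λ j → proj₁ (resting-block x _ _ (rest j))
    all-served : ∑ (λ j → hitsE x (slot σ j) (kinds false (cnt j))) ≡ m
    all-served = trans (sum-cong-≗ (λ j → proj₁ (proj₂ (resting-block x _ _ (rest j))))) (trans (∑-const m 1) (ℕP.*-identityʳ m))

  labelled-block : ∀ σ cnt k → (∀ j → j ≢ k → Resting (cnt j) (slot σ j)) → ServesOnce (busy σ) (cnt k) (slot σ k) →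
                   Outcome σ (blockReqs (just k) cnt) (updateAt (slot σ) k (λ h → runE (busy σ) h (kinds true (cnt k)))) m
  labelled-block σ cnt k rest once = Outcome-≡ new all-served O
    where
    x = busy σ
    F = λ h → runE x h (kinds true (cnt k))
    room : Room (point k (spare x)) x
    room = subst (λ s → s + bit x ≤ 1) (sym (∑-point k (spare x))) (spare+busy x)
    O = serve-block σ (just k) cnt (point k (spare x)) room
          (by-label (λ j l → peak x (slot σ j) (kinds l (cnt j)) ≤ 2 + (if l then spare x else 0)) k
             (proj₂ once) (λ j j≢k → proj₂ (proj₂ (resting-block x _ _ (rest j j≢k)))))
    all-served : ∑ (λ j → hitsE x (slot σ j) (kinds (isLabel (just k) j) (cnt j))) ≡ m
    all-served = trans (sum-cong-≗ (by-label (λ j l → hitsE x (slot σ j) (kinds l (cnt j)) ≡ 1) k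
                                      (proj₁ once) (λ j j≢k → proj₁ (proj₂ (resting-block x _ _ (rest j j≢k))))))
                       (trans (∑-const m 1) (ℕP.*-identityʳ m))
    new : ∀ j → runE x (slot σ j) (kinds (isLabel (just k) j) (cnt j)) ≡ updateAt (slot σ) k F j
    new = by-label (λ j l → runE x (slot σ j) (kinds l (cnt j)) ≡ updateAt (slot σ) k F j) k
            (sym (updateAt-updates k (slot σ)))
            (λ j j≢k → trans (proj₁ (resting-block x _ _ (rest j j≢k))) (sym (updateAt-minimal j k (slot σ) j≢k)))

  Outcome-++[] : ∀ {σ rs f x} → Outcome σ rs f x → Outcome σ (rs ++ []) f x
  Outcome-++[] {σ} {rs} {f} {x} = subst (λ qs → Outcome σ qs f x) (sym (ListP.++-identityʳ rs))

  pair-blocks : ∀ σ cnt k → (∀ j → j ≢ k → Resting (cnt j) (slot σ j)) → Ready (busy σ) (cnt k) (slot σ k) →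
                Outcome σ (render cnt (block (just k) ∷ block (just k) ∷ []))
                        (updateAt (slot σ) k (afterPair (busy σ) (cnt k))) (m + m)
  pair-blocks σ cnt k rest ready = Outcome-≡ combined refl (Outcome-++ O₁ (Outcome-++[] O₂))
    where
    x = busy σ
    servesTwice = ready-pair x (cnt k) (slot σ k) ready
    F₁ = λ h → runE x h (kinds true (cnt k))
    O₁ = labelled-block σ cnt k rest (proj₁ servesTwice)
    σ₁ = final σ (blockReqs (just k) cnt)
    cnt₁ = bump (just k) cnt
    busy≡ : busy σ₁ ≡ x
    busy≡ = cong is-just (Outcome.vslot≡ O₁)
    slot₁ : ∀ j → slot σ₁ j ≡ updateAt (slot σ) k F₁ j
    slot₁ = Outcome.slot≡ O₁
    slot₁-k : slot σ₁ k ≡ F₁ (slot σ k)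
    slot₁-k = trans (slot₁ k) (updateAt-updates k (slot σ))
    slot₁-≢ : ∀ j → j ≢ k → slot σ₁ j ≡ slot σ j
    slot₁-≢ j j≢k = trans (slot₁ j) (updateAt-minimal j k (slot σ) j≢k)
    rest₁ : ∀ j → j ≢ k → Resting (cnt₁ j) (slot σ₁ j)
    rest₁ j j≢k = subst₂ Resting (sym (bump-other cnt j≢k)) (sym (slot₁-≢ j j≢k)) (rest j j≢k)
    transport : ∀ {y c h y′ c′ h′} → y′ ≡ y → c′ ≡ c → h′ ≡ h → ServesOnce y c h → ServesOnce y′ c′ h′
    transport refl refl refl once = once
    O₂ = labelled-block σ₁ cnt₁ k rest₁ (transport busy≡ (bump-self cnt k) slot₁-k (proj₂ servesTwice))
    combined : ∀ j → updateAt (slot σ₁) k (λ h → runE (busy σ₁) h (kinds true (cnt₁ k))) j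
                   ≡ updateAt (slot σ) k (afterPair x (cnt k)) j
    combined j with j ≟ k
    ... | yes refl = begin
      updateAt (slot σ₁) j (λ h → runE (busy σ₁) h (kinds true (cnt₁ j))) j ≡⟨ updateAt-updates j (slot σ₁) ⟩
      runE (busy σ₁) (slot σ₁ j) (kinds true (cnt₁ j))
        ≡⟨ cong₂ (λ y h → runE y h (kinds true (cnt₁ j))) busy≡ slot₁-k ⟩
      runE x (F₁ (slot σ j)) (kinds true (cnt₁ j))                           ≡⟨ cong (λ c → runE x (F₁ (slot σ j)) (kinds true c)) (bump-self cnt j) ⟩
      afterPair x (cnt j) (slot σ j)                                         ≡⟨ updateAt-updates j (slot σ) ⟨
      updateAt (slot σ) j (afterPair x (cnt j)) j                            ∎
      where open ≡-Reasoning
    ... | no  j≢k  = trans (updateAt-minimal j k (slot σ₁) j≢k) (trans (slot₁-≢ j j≢k) (sym (updateAt-minimal j k (slot σ) j≢k)))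

  initial-block : ∀ σ cnt → (∀ j → cnt j ≡ 0) → (∀ j → slot σ j ≡ nothing) →
                  Outcome σ (blockReqs nothing cnt) (λ _ → just ā) 0
  initial-block σ cnt fresh empty = Outcome-≡ loads-ā none-served (serve-block σ nothing cnt (λ _ → 0) (no-extra x) peaks)
    where
    x = busy σ
    first : ∀ j → kinds false (cnt j) ≡ ā ∷ []
    first j = cong (kinds false) (fresh j)
    peaks : ∀ j → peak x (slot σ j) (kinds false (cnt j)) ≤ 2
    peaks j rewrite first j | empty j = ℕP.≤-refl
    loads-ā : ∀ j → runE x (slot σ j) (kinds false (cnt j)) ≡ just ā
    loads-ā j rewrite first j | empty j = refl
    none-served : ∑ (λ j → hitsE x (slot σ j) (kinds false (cnt j))) ≡ 0
    none-served = trans (sum-cong-≗ λ j → cong₂ (hitsE x) (empty j) (first j)) (∑-zero m)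

module Construction {n m : ℕ} (G : Graph n m) (O : IncidenceOrder G) (S : Subset n)
  (independent : ∀ k → ¬ (proj₁ (edge G k) Sub.∈ S × proj₂ (edge G k) Sub.∈ S)) where

  open Service {n} {m} S
  open import Data.List.Membership.DecPropositional (_≟_ {n}) using (_∈?_)
  open import Data.List.Membership.DecPropositional (_≟_ {m}) using () renaming (_∈?_ to _∈?ₑ_)

  end₁ end₂ : Fin m → Fin n
  end₁ k = proj₁ (edge G k)
  end₂ k = proj₂ (edge G k)

  not-both : ∀ k → inS (end₁ k) ≡ true → inS (end₂ k) ≡ false
  not-both k in₁ with inS (end₂ k) in in₂
  ... | false = refl
  ... | true  = ⊥-elim (independent k (lookup⇒[]= (end₁ k) S in₁ , lookup⇒[]= (end₂ k) S in₂))

  not-both′ : ∀ k → inS (end₂ k) ≡ true → inS (end₁ k) ≡ false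
  not-both′ k in₂ with inS (end₁ k) in in₁
  ... | false = refl
  ... | true  = ⊥-elim (independent k (lookup⇒[]= (end₁ k) S in₁ , lookup⇒[]= (end₂ k) S in₂))

  -- whether the phase of v is still ahead, R being the vertices whose phases are ahead
  ahead : Fin n → List (Fin n) → Bool
  ahead v R = does (v ∈? R)

  ahead-self : ∀ v R → ahead v (v ∷ R) ≡ true
  ahead-self v R rewrite dec-true (v ≟ v) refl = refl

  ahead-other : ∀ {u v} R → u ≢ v → ahead u (v ∷ R) ≡ ahead u R
  ahead-other {u} {v} R u≢v rewrite dec-false (u ≟ v) u≢v = refl

  EInv : List (Fin n) → Fin m → ℕ → Slot → Set
  EInv R k = EdgeInv (ahead (end₁ k) R) (ahead (end₂ k) R) (inS (end₁ k)) (inS (end₂ k))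

  EInv-other : ∀ v R k {c h} → ¬ Incident G v k → EInv (v ∷ R) k c h → EInv R k c h
  EInv-other v R k {c} {h} not-inc =
    subst₂ (λ p q → EdgeInv p q (inS (end₁ k)) (inS (end₂ k)) c h)
           (ahead-other R (λ e → not-inc (inj₁ (sym e)))) (ahead-other R (λ e → not-inc (inj₂ (sym e))))

  transit : ∀ v R k c h → Incident G v k → v ∉ R → EInv (v ∷ R) k c h →
            Ready (inS v) c h × EInv R k (2 + c) (afterPair (inS v) c h)
  transit _ R k c h (inj₁ refl) v∉R inv
    with pair-advance (ahead (end₂ k) R) _ _ c h (not-both k)
           (subst₂ (λ p q → EdgeInv p q (inS (end₁ k)) (inS (end₂ k)) c h)
                   (ahead-self (end₁ k) R) (ahead-other R (noLoop G k ∘ sym)) inv)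
  ... | ready , inv′ = ready , subst (λ p → EdgeInv p (ahead (end₂ k) R) _ _ _ _) (sym (dec-false (_ ∈? R) v∉R)) inv′
  transit _ R k c h (inj₂ refl) v∉R inv
    with pair-advance (ahead (end₁ k) R) _ _ c h (not-both′ k)
           (EdgeInv-sym _ _ _ _ c h (subst₂ (λ p q → EdgeInv p q (inS (end₁ k)) (inS (end₂ k)) c h)
                   (ahead-other R (noLoop G k)) (ahead-self (end₂ k) R) inv))
  ... | ready , inv′ = ready , subst (λ q → EdgeInv (ahead (end₁ k) R) q _ _ _ _) (sym (dec-false (_ ∈? R) v∉R))
                                     (EdgeInv-sym _ _ _ _ _ _ inv′)

  Between : List (Fin n) → (Fin m → ℕ) → State → Set
  Between R cnt σ = vslot σ ≡ nothing × (∀ k → EInv R k (cnt k) (slot σ k))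

  record During (v : Fin n) (R : List (Fin n)) (ks : List (Fin m)) (cnt : Fin m → ℕ) (σ : State) : Set where
    field
      vslot≡  : vslot σ ≡ opening v
      pending : ∀ k → k ∈ ks → EInv (v ∷ R) k (cnt k) (slot σ k)
      settled : ∀ k → k ∉ ks → EInv R k (cnt k) (slot σ k)

  During-resting : ∀ {v R ks cnt σ} → During v R ks cnt σ → ∀ j → Resting (cnt j) (slot σ j)
  During-resting {ks = ks} during j with j ∈?ₑ ks
  ... | yes j∈ks = EdgeInv-resting _ _ _ _ _ _ (During.pending during j j∈ks)
  ... | no  j∉ks = EdgeInv-resting _ _ _ _ _ _ (During.settled during j j∉ks)

  -- Serving the requests rendered from the items `is` with counters cnt:
  -- the caches fit, Post holds afterwards, the savings are hits + V/(n+1),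
  -- and hits grows by m with each block associated with an edge.
  record Stage (cnt : Fin m → ℕ) (σ : State) (is : List (Item n m)) (Post : (Fin m → ℕ) → State → Set) (V : ℕ) : Set where
    field
      hits  : ℕ
      fits  : Fits σ (render cnt is)
      post  : Post (after cnt is) (final σ (render cnt is))
      gain≡ : gain σ (render cnt is) ≡ worth n hits V
      count : hits + m * ∑ cnt ≡ m * ∑ (after cnt is)

  Stage-[] : ∀ {cnt σ} {Post : (Fin m → ℕ) → State → Set} → Post cnt σ → Stage cnt σ [] Post 0
  Stage-[] p = record { hits = 0 ; fits = tt ; post = p ; gain≡ = sym (worth-0 n) ; count = refl }

  Stage-++ : ∀ {cnt σ xs ys P Q V W} → Stage cnt σ xs P V → (∀ {c τ} → P c τ → Stage c τ ys Q W) →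
             Stage cnt σ (xs ++ ys) Q (V + W)
  Stage-++ {cnt} {σ} {xs} {ys} {Q = Q} {V} {W} s₁ continue = record
    { hits  = hits s₁ + hits s₂
    ; fits  = subst (Fits σ) (sym split) (Fits-++ σ (render cnt xs) (render c₁ ys) (fits s₁) (fits s₂))
    ; post  = subst₂ Q (sym (after-++ cnt xs ys))
                       (sym (trans (cong (final σ) split) (final-++ σ (render cnt xs) (render c₁ ys)))) (post s₂)
    ; gain≡ = trans (cong (gain σ) split) (trans (gain-++ σ (render cnt xs) (render c₁ ys))
                (trans (cong₂ _+ℚ_ (gain≡ s₁) (gain≡ s₂)) (worth-+ n (hits s₁) V (hits s₂) W)))
    ; count = begin
        (hits s₁ + hits s₂) + m * ∑ cnt   ≡⟨ reassoc (hits s₁) (hits s₂) (m * ∑ cnt) ⟩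
        hits s₂ + (hits s₁ + m * ∑ cnt)   ≡⟨ cong (_+_ (hits s₂)) (count s₁) ⟩
        hits s₂ + m * ∑ c₁                ≡⟨ count s₂ ⟩
        m * ∑ (after c₁ ys)               ≡⟨ cong (λ c → m * ∑ c) (after-++ cnt xs ys) ⟨
        m * ∑ (after cnt (xs ++ ys))      ∎
    }
    where
    open Stage
    open ≡-Reasoning
    c₁ = after cnt xs
    s₂ = continue (post s₁)
    split : render cnt (xs ++ ys) ≡ render cnt xs ++ render c₁ ys
    split = render-++ cnt xs ys
    reassoc : ∀ p q r → (p + q) + r ≡ q + (p + r)
    reassoc = ℕ-solve

  open-phase : ∀ v R cnt σ → Between (v ∷ R) cnt σ → Stage cnt σ (vreq v ∷ []) (During v R (order O v)) 0
  open-phase v R cnt σ (empty , inv) = record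
    { hits  = 0
    ; fits  = fits-budget σ′ (λ _ → 0) (no-extra (busy σ′))
                (λ k → resting-size (EdgeInv-resting _ _ _ _ _ _ (inv k))) , tt
    ; post  = record
      { vslot≡  = cong (λ V → vstep V v) empty
      ; pending = λ k _ → inv k
      ; settled = λ k k∉ → EInv-other v R k (k∉ ∘ proj₂ (complete O v k)) (inv k) }
    ; gain≡ = trans (cong (λ V → (if holdsV V v then cost (vpage {n} {m} v) else 0ℚ) +ℚ 0ℚ) empty)
                    (trans (ℚP.+-identityʳ 0ℚ) (sym (worth-0 n)))
    ; count = refl
    }
    where σ′ = step σ (vpage v)

  close-phase : ∀ v R cnt σ → During v R [] cnt σ → Stage cnt σ (vreq v ∷ []) (Between R) (bit (inS v))
  close-phase v R cnt σ during = record
    { hits  = 0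
    ; fits  = fits-budget σ′ (λ _ → 0) (no-extra (busy σ′)) (λ k → resting-size (During-resting during k)) , tt
    ; post  = trans (cong (λ V → vstep V v) opened) (closing v) , λ k → During.settled during k λ ()
    ; gain≡ = trans (cong (λ V → (if holdsV V v then cost (vpage {n} {m} v) else 0ℚ) +ℚ 0ℚ) opened)
                    (trans (cong (λ x → (if x then cost (vpage {n} {m} v) else 0ℚ) +ℚ 0ℚ) (holds-opening v))
                           (vertex-worth n (inS v)))
    ; count = refl
    }
    where
    σ′ = step σ (vpage v)
    opened = During.vslot≡ during

  two-blocks : ∀ (cnt : Fin m → ℕ) k → (m + m) + m * ∑ cnt ≡ m * ∑ (bump (just k) (bump (just k) cnt))
  two-blocks cnt k = begin
    (m + m) + m * ∑ cnt                    ≡⟨ twice m (∑ cnt) ⟩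
    m * suc (suc (∑ cnt))                  ≡⟨ cong (m *_) (trans (∑-bump (bump (just k) cnt) k) (cong suc (∑-bump cnt k))) ⟨
    m * ∑ (bump (just k) (bump (just k) cnt)) ∎
    where
    open ≡-Reasoning
    twice : ∀ p q → (p + p) + p * q ≡ p * suc (suc q)
    twice = ℕ-solve

  pair-stage : ∀ v R k ks cnt σ → v ∉ R → k ∉ ks → Incident G v k → During v R (k ∷ ks) cnt σ →
               Stage cnt σ (block (just k) ∷ block (just k) ∷ []) (During v R ks) 0
  pair-stage v R k ks cnt σ v∉R k∉ks inc during = record
    { hits  = m + m
    ; fits  = Outcome.fits P
    ; post  = record
      { vslot≡  = trans (Outcome.vslot≡ P) (During.vslot≡ during)
      ; pending = λ j j∈ks → subst₂ (EInv (v ∷ R) j) (sym (counter-≢ (≢k j∈ks))) (sym (slot-≢ (≢k j∈ks)))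
                                    (During.pending during j (there j∈ks))
      ; settled = settled }
    ; gain≡ = Outcome.gain≡ P
    ; count = two-blocks cnt k
    }
    where
    x = busy σ
    cnt₁ = bump (just k) cnt
    cnt₂ = bump (just k) cnt₁
    busy≡ : x ≡ inS v
    busy≡ = trans (cong is-just (During.vslot≡ during)) (busy-opening v)
    advance = transit v R k (cnt k) (slot σ k) inc v∉R (During.pending during k (here refl))
    P = pair-blocks σ cnt k (λ j _ → During-resting during j) (subst (λ z → Ready z (cnt k) (slot σ k)) (sym busy≡) (proj₁ advance))
    σ₂ = final σ (render cnt (block (just k) ∷ block (just k) ∷ []))
    ≢k : ∀ {j} → j ∈ ks → j ≢ k
    ≢k j∈ks refl = k∉ks j∈ks
    counter-≢ : ∀ {j} → j ≢ k → cnt₂ j ≡ cnt j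
    counter-≢ j≢k = trans (bump-other cnt₁ j≢k) (bump-other cnt j≢k)
    slot-≢ : ∀ {j} → j ≢ k → slot σ₂ j ≡ slot σ j
    slot-≢ {j} j≢k = trans (Outcome.slot≡ P j) (updateAt-minimal j k (slot σ) j≢k)
    settled : ∀ j → j ∉ ks → EInv R j (cnt₂ j) (slot σ₂ j)
    settled j j∉ks with j ≟ k
    ... | yes refl = subst₂ (EInv R j) (sym (trans (bump-self cnt₁ j) (cong suc (bump-self cnt j))))
                       (sym (trans (Outcome.slot≡ P j) (trans (updateAt-updates j (slot σ))
                                   (cong (λ z → afterPair z (cnt j) (slot σ j)) busy≡))))
                       (proj₂ advance)
    ... | no  j≢k  = subst₂ (EInv R j) (sym (counter-≢ j≢k)) (sym (slot-≢ j≢k))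
                       (During.settled during j λ { (here j≡k) → j≢k j≡k ; (there j∈ks) → j∉ks j∈ks })

  pairItems : List (Fin m) → List (Item n m)
  pairItems = concatMap (λ k → block (just k) ∷ block (just k) ∷ [])

  pairs-stage : ∀ v R ks cnt σ → v ∉ R → Unique ks → (∀ k → k ∈ ks → Incident G v k) →
                During v R ks cnt σ → Stage cnt σ (pairItems ks) (During v R []) 0
  pairs-stage v R []       cnt σ v∉R _                   _   during = Stage-[] during
  pairs-stage v R (k ∷ ks) cnt σ v∉R (k-fresh ∷ uniq) inc during =
    Stage-++ (pair-stage v R k ks cnt σ v∉R (All¬⇒¬Any k-fresh) (inc k (here refl)) during)
             (pairs-stage v R ks _ _ v∉R uniq (λ j j∈ks → inc j (there j∈ks)))

  phaseItems : Fin n → List (Item n m)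
  phaseItems v = vreq v ∷ (pairItems (order O v) ++ (vreq v ∷ []))

  phase-stage : ∀ v R cnt σ → v ∉ R → Between (v ∷ R) cnt σ → Stage cnt σ (phaseItems v) (Between R) (bit (inS v))
  phase-stage v R cnt σ v∉R between =
    Stage-++ (open-phase v R cnt σ between) λ during →
    Stage-++ (pairs-stage v R (order O v) _ _ v∉R (unique O v) (λ k → proj₁ (complete O v k)) during) λ done →
    close-phase v R _ _ done

  phases-stage : ∀ R cnt σ → Unique R → Between R cnt σ →
                 Stage cnt σ (concatMap phaseItems R) (Between []) (sumL R (bit ∘ inS))
  phases-stage []      cnt σ _                between = Stage-[] between
  phases-stage (v ∷ R) cnt σ (v-fresh ∷ uniq) between =
    Stage-++ (phase-stage v R cnt σ (All¬⇒¬Any v-fresh) between) (phases-stage R _ _ uniq)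

  σ₀ : State
  σ₀ = ⟨ (λ _ → nothing) , nothing ⟩

  initial-stage : Stage (λ _ → 0) σ₀ (block nothing ∷ []) (Between (allFin n)) 0
  initial-stage = record
    { hits  = 0
    ; fits  = Outcome.fits I
    ; post  = Outcome.vslot≡ I , λ k → subst₂ (λ p q → EdgeInv p q (inS (end₁ k)) (inS (end₂ k)) 0 (slot σ₁ k))
                                          (sym (all-ahead (end₁ k))) (sym (all-ahead (end₂ k))) (refl , Outcome.slot≡ I k)
    ; gain≡ = Outcome.gain≡ I
    ; count = refl
    }
    where
    I = Outcome-++[] (initial-block σ₀ (λ _ → 0) (λ _ → refl) (λ _ → refl))
    σ₁ = final σ₀ (render (λ _ → 0) (block nothing ∷ []))
    all-ahead : ∀ v → ahead v (allFin n) ≡ true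
    all-ahead v = dec-true (v ∈? allFin n) (∈-allFin v)

  whole-service : Fits σ₀ (requests G O) × gain σ₀ (requests G O) ≡ worth n ((4 * m + 1) * m) Sub.∣ S ∣
  whole-service = subst (Fits σ₀) (sym split) (Fits-++ σ₀ _ _ (Stage.fits main) (Outcome.fits F)) , (begin
    gain σ₀ (requests G O)                          ≡⟨ cong (gain σ₀) split ⟩
    gain σ₀ (render (λ _ → 0) prefix ++ render cntF (block nothing ∷ []))
                                                    ≡⟨ gain-++ σ₀ (render (λ _ → 0) prefix) _ ⟩
    gain σ₀ (render (λ _ → 0) prefix) +ℚ gain σF (render cntF (block nothing ∷ []))
                                                    ≡⟨ cong₂ _+ℚ_ (Stage.gain≡ main) (Outcome.gain≡ F) ⟩
    worth n (Stage.hits main) (sumL (allFin n) (bit ∘ inS)) +ℚ worth n m 0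
                                                    ≡⟨ worth-+ n (Stage.hits main) (sumL (allFin n) (bit ∘ inS)) m 0 ⟩
    worth n (Stage.hits main + m) (sumL (allFin n) (bit ∘ inS) + 0)
                                                    ≡⟨ cong₂ (worth n) edge-hits vertex-hits ⟩
    worth n ((4 * m + 1) * m) Sub.∣ S ∣             ∎)
    where
    open ≡-Reasoning
    prefix = block nothing ∷ concatMap phaseItems (allFin n)
    main = Stage-++ initial-stage (phases-stage (allFin n) _ _ (allFin⁺ n))
    cntF = after (λ _ → 0) prefix
    σF = final σ₀ (render (λ _ → 0) prefix)
    split : requests G O ≡ render (λ _ → 0) prefix ++ render cntF (block nothing ∷ [])
    split = render-++ (λ _ → 0) prefix (block nothing ∷ [])
    done : ∀ k → cntF k ≡ 4 × slot σF k ≡ just b̄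
    done k = proj₂ (Stage.post main) k
    F = Outcome-++[] (resting-unlabelled σF cntF (λ k → inj₂ (inj₂ (inj₂ (done k)))))
    counted : Stage.hits main + m * 0 ≡ m * (m * 4)
    counted = trans (cong (λ s → Stage.hits main + m * s) (sym (∑-zero m)))
                    (trans (Stage.count main) (cong (m *_) (trans (sum-cong-≗ (proj₁ ∘ done)) (∑-const m 4))))
    edge-hits : Stage.hits main + m ≡ (4 * m + 1) * m
    edge-hits = trans (cong (_+ m) (trans (sym (rearr-0 (Stage.hits main) m)) counted)) (rearr-total m)
      where
      rearr-0 : ∀ p q → p + q * 0 ≡ p
      rearr-0 = ℕ-solve
      rearr-total : ∀ q → q * (q * 4) + q ≡ (4 * q + 1) * q
      rearr-total = ℕ-solve
    vertex-hits : sumL (allFin n) (bit ∘ inS) + 0 ≡ Sub.∣ S ∣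
    vertex-hits = trans (ℕP.+-identityʳ _) (trans (sumL-allFin (bit ∘ inS)) (∑-bits S))

lemma9 : (n m : ℕ) (G : Graph n m) (O : IncidenceOrder G) (K : ℕ) →
    IndependentSet G K →
    Σ (List (Cache n m)) λ s →
    ValidService (capacity m) emptyCache (requests G O) s ×
    savings emptyCache (requests G O) s ≡ (+ (((4 * m + 2) ∸ 1) * m) /ℚ 1) +ℚ (+ K /ℚ suc n)
lemma9 n m G O K (S , |S|≡K , independent) =
  run σ₀ (requests G O) ,
  serves σ₀ (requests G O) starts-empty fits ,
  (begin
    savings emptyCache (requests G O) (run σ₀ (requests G O)) ≡⟨ saves σ₀ (requests G O) starts-empty ⟩
    gain σ₀ (requests G O)                                   ≡⟨ saved ⟩
    worth n ((4 * m + 1) * m) Sub.∣ S ∣                      ≡⟨ cong₂ (worth n) (cong (_* m) d-1) |S|≡K ⟩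
    worth n (((4 * m + 2) ∸ 1) * m) K                        ∎)
  where
  open Construction G O S independent
  open Service S
  open ≡-Reasoning
  fits = proj₁ whole-service
  saved = proj₂ whole-service
  starts-empty : ∀ p → emptyCache p ≡ cacheOf σ₀ p
  starts-empty (vpage v)   = refl
  starts-empty (epage t k) = refl
  d-1 : 4 * m + 1 ≡ (4 * m + 2) ∸ 1
  d-1 = sym (ℕP.+-∸-assoc (4 * m) (s≤s z≤n))
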